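{- Let $p$ be a prime, $d,k$ positive integers, $s\ge 0$ an integer, and let $\mathbf m,\mathbf L,\mathbf N^{(1)},\dots,\mathbf N^{(k)}\in\mathbb{Z}^d$ with $\mathbf m\ge\mathbf 0$, $\mathbf 0\le\mathbf L\le\mathbf N^{(1)}$, and $\mathbf N^{(j)}\ge\mathbf 0$ for all $j$. Then $$B_{\mathbf N}(\mathbf m)\Big(H_{\sum_{i=1}^{d}L_im_ip^s}-H_{\sum_{i=1}^{d}L_i\lfloor m_i/p\rfloor p^{s+1}}\Big)\in\frac{1}{p^s}\,\mathbb{Z}_p.$$
   Context: For $\mathbf P,\mathbf m\in\mathbb{Z}^d$ with $\mathbf P,\mathbf m\ge\mathbf 0$, $B(\mathbf P,\mathbf m)=\big(\sum_{i=1}^dP_im_i\big)!\big/\prod_{i=1}^dm_i!^{P_i}$, and $B_{\mathbf N}(\mathbf m)=\prod_{j=1}^kB(\mathbf N^{(j)},\mathbf m)$. $H_m=\sum_{j=1}^m1/j$ with $H_0=0$. Vector inequalities are componentwise. $\mathbb{Z}_p$ denotes the $p$-adic integers. -}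

module Defs where

open import Data.Nat as ℕ using (ℕ; zero; suc; NonZero; _!)
open import Data.Nat.Properties using (m*n≢0; m^n≢0; _!≢0)
open import Data.Nat.Divisibility using (_∣_)
open import Data.Fin using (Fin; zero; suc)
open import Data.Integer using (+_)
open import Data.Rational as ℚ using (ℚ; 0ℚ; _/_)
open import Relation.Nullary using (¬_)

∑ : ∀ {d} → (Fin d → ℕ) → ℕ
∑ {zero}  f = 0
∑ {suc d} f = f zero ℕ.+ ∑ (λ i → f (suc i))

denB : ∀ {d} → (P m : Fin d → ℕ) → ℕ
denB {zero}  P m = 1
denB {suc d} P m = (((m zero) !) ℕ.^ P zero) ℕ.* denB (λ i → P (suc i)) (λ i → m (suc i))

denB≢0 : ∀ {d} (P m : Fin d → ℕ) → NonZero (denB P m)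
denB≢0 {zero}  P m = _
denB≢0 {suc d} P m =
  let instance
        _ = (m zero) !≢0
        _ = m^n≢0 ((m zero) !) (P zero)
        _ = denB≢0 (λ i → P (suc i)) (λ i → m (suc i))
  in m*n≢0 (((m zero) !) ℕ.^ P zero) (denB (λ i → P (suc i)) (λ i → m (suc i)))

B : ∀ {d} → (P m : Fin d → ℕ) → ℚ
B P m = ((+ ((∑ (λ i → P i ℕ.* m i)) !)) / denB P m) {{denB≢0 P m}}

BN : ∀ {k d} → (N : Fin k → Fin d → ℕ) → (m : Fin d → ℕ) → ℚ
BN {zero}  N m = ℚ.1ℚ
BN {suc k} N m = B (N zero) m ℚ.* BN (λ j → N (suc j)) m

H : ℕ → ℚ
H zero    = 0ℚ
H (suc n) = H n ℚ.+ (+ 1) / suc n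

-- a rational q lies in ℤ_p iff p does not divide its reduced denominator
InZp : ℕ → ℚ → Set
InZp p q = ¬ (p ∣ ℚ.denominatorℕ q)

-- q ∈ p^{-s} ℤ_p  iff  p^s · q ∈ ℤ_p
InPowZp : ℕ → ℕ → ℚ → Set
InPowZp p s q = InZp p (((+ (p ℕ.^ s)) / 1) ℚ.* q)

{-# OPTIONS --safe #-}
-- After multiplying by p^s, the claim is that every term p^s B_N(m) / j with
-- n' < j ≤ n is p-integral, where n = A p^s, n' = Q p^(s+1), A = Σ L_i m_i and
-- Q = Σ L_i ⌊m_i/p⌋. All B(P,m) are integers and B(L,m) ∣ B(N^(1),m) ∣ B_N(m),
-- so it suffices that ν_p(j) ≤ s + ν_p(B(L,m)). If ν_p(j) = s+1+r, then
-- j = p^(s+1) t with p^r ∣ t and Q < t ≤ A/p. Legendre's formula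
-- ν_p(n!) = ⌊n/p⌋ + ν_p(⌊n/p⌋!) gives ν_p(∏ m_i!^{L_i}) = Q + ν_p(∏ ⌊m_i/p⌋!^{L_i})
-- ≤ Q + ν_p(Q!), while ν_p(A!) = A/p + ν_p((A/p)!) ≥ A/p + ν_p(Q!) + ν_p(t)
-- because Q! t ∣ (A/p)!; hence ν_p(B(L,m)) ≥ A/p - Q + r ≥ r + 1.
module Submission where

open import Defs
open import Data.Nat using (ℕ; suc; _+_; _*_; _^_; _/_; _≤_; _<_; NonZero)
open import Data.Nat.Primality using (Prime)
open import Data.Fin using (Fin; fromℕ<)
open import Data.Rational using (_-_) renaming (_*_ to _*ℚ_)

open import Data.Nat
  using (zero; _∸_; _%_; _!; z≤n; s≤s; z<s; >-nonZero; >-nonZero⁻¹; ≢-nonZero⁻¹; nonTrivial⇒n>1)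
open import Data.Nat.Properties
open import Data.Nat.Divisibility
open import Data.Nat.DivMod using (m≡m%n+[m/n]*n; m%n<n; m*n/n≡m; m/n*n≤m; /-monoˡ-≤)
open import Data.Nat.Combinatorics using (k![n∸k]!∣n!)
open import Data.Nat.Primality using (euclidsLemma; prime⇒nonZero; prime⇒nonTrivial)
open import Data.Nat.GCD using (gcd)
open import Data.Nat.Induction using (<-rec)
open import Data.Nat.Solver using (module +-*-Solver)
open import Data.Fin using (zero; suc)
import Data.Integer as ℤ
import Data.Integer.Properties as ℤP
open import Data.Rational as ℚ using (ℚ; mkℚ; 0ℚ)
import Data.Rational.Properties as ℚP
import Data.Rational.Unnormalised as ℚᵘ
import Data.Rational.Unnormalised.Properties as ℚᵘP
open import Algebra.Properties.AbelianGroup ℚP.+-0-abelianGroup using (xyx⁻¹≈y)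
open import Data.Product using (∃; ∃₂; _×_; _,_)
open import Data.Sum using (inj₁; inj₂)
open import Data.Empty using (⊥-elim)
open import Function using (_∘_)
open import Relation.Nullary using (¬_; yes; no)
open import Relation.Binary.PropositionalEquality

open _∣_ using (equality)
open +-*-Solver

∑-cong : ∀ {d} {f g : Fin d → ℕ} → (∀ i → f i ≡ g i) → ∑ f ≡ ∑ g
∑-cong {zero}  f≗g = refl
∑-cong {suc d} f≗g = cong₂ _+_ (f≗g zero) (∑-cong (f≗g ∘ suc))

∑-mono-≤ : ∀ {d} {f g : Fin d → ℕ} → (∀ i → f i ≤ g i) → ∑ f ≤ ∑ g
∑-mono-≤ {zero}  f≤g = z≤n
∑-mono-≤ {suc d} f≤g = +-mono-≤ (f≤g zero) (∑-mono-≤ (f≤g ∘ suc))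

∑-distrib-+ : ∀ {d} (f g : Fin d → ℕ) → ∑ (λ i → f i + g i) ≡ ∑ f + ∑ g
∑-distrib-+ {zero}  f g = refl
∑-distrib-+ {suc d} f g = begin
  f zero + g zero + ∑ (λ i → f (suc i) + g (suc i)) ≡⟨ cong ((f zero + g zero) +_) (∑-distrib-+ (f ∘ suc) (g ∘ suc)) ⟩
  f zero + g zero + (∑ (f ∘ suc) + ∑ (g ∘ suc))     ≡⟨ +-+-interchange ⟩
  f zero + ∑ (f ∘ suc) + (g zero + ∑ (g ∘ suc))     ∎
  where
  open ≡-Reasoning
  +-+-interchange = solve 4 (λ a b c e → a :+ b :+ (c :+ e) := a :+ c :+ (b :+ e)) refl
                      (f zero) (g zero) (∑ (f ∘ suc)) (∑ (g ∘ suc))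

∑-distribʳ-* : ∀ {d} (f : Fin d → ℕ) c → ∑ (λ i → f i * c) ≡ ∑ f * c
∑-distribʳ-* {zero}  f c = refl
∑-distribʳ-* {suc d} f c =
  trans (cong (f zero * c +_) (∑-distribʳ-* (f ∘ suc) c)) (sym (*-distribʳ-+ c (f zero) (∑ (f ∘ suc))))

m*n>0 : ∀ {m n} → 0 < m → 0 < n → 0 < m * n
m*n>0 {suc m} {suc n} _ _ = z<s

m!*n!∣[m+n]! : ∀ m n → m ! * n ! ∣ (m + n) !
m!*n!∣[m+n]! m n = subst (λ k → m ! * k ! ∣ (m + n) !) (m+n∸m≡n m n) (k![n∸k]!∣n! (m≤m+n m n))

[m!]^k∣[k*m]! : ∀ k m → (m !) ^ k ∣ (k * m) !
[m!]^k∣[k*m]! zero    m = ∣-refl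
[m!]^k∣[k*m]! (suc k) m = ∣-trans (*-monoʳ-∣ (m !) ([m!]^k∣[k*m]! k m)) (m!*n!∣[m+n]! m (k * m))

m!*n∣k! : ∀ {m n k} → m < n → n ≤ k → m ! * n ∣ k !
m!*n∣k! {m} {suc n} (s≤s m≤n) n<k =
  ∣-trans (subst (_∣ suc n !) (*-comm (suc n) (m !)) (*-monoʳ-∣ (suc n) (m≤n⇒m!∣n! m≤n))) (m≤n⇒m!∣n! n<k)

denB∣! : ∀ {d} (P m : Fin d → ℕ) → denB P m ∣ (∑ (λ i → P i * m i)) !
denB∣! {zero}  P m = ∣-refl
denB∣! {suc d} P m =
  ∣-trans (*-pres-∣ ([m!]^k∣[k*m]! (P zero) (m zero)) (denB∣! (P ∘ suc) (m ∘ suc)))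
          (m!*n!∣[m+n]! (P zero * m zero) _)

denB>0 : ∀ {d} (P m : Fin d → ℕ) → 0 < denB P m
denB>0 P m = >-nonZero⁻¹ _ {{denB≢0 P m}}

denB-+ : ∀ {d} (N L K m : Fin d → ℕ) → (∀ i → N i ≡ L i + K i) → denB N m ≡ denB L m * denB K m
denB-+ {zero}  N L K m N≡L+K = refl
denB-+ {suc d} N L K m N≡L+K = begin
  x ^ N zero * denB (N ∘ suc) m′                                  ≡⟨ cong₂ _*_ x^N≡x^L*x^K (denB-+ (N ∘ suc) (L ∘ suc) (K ∘ suc) m′ (N≡L+K ∘ suc)) ⟩
  x ^ L zero * x ^ K zero * (denB (L ∘ suc) m′ * denB (K ∘ suc) m′) ≡⟨ *-*-interchange ⟩
  x ^ L zero * denB (L ∘ suc) m′ * (x ^ K zero * denB (K ∘ suc) m′) ∎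
  where
  open ≡-Reasoning
  x = m zero !
  m′ = m ∘ suc
  x^N≡x^L*x^K = trans (cong (x ^_) (N≡L+K zero)) (^-distribˡ-+-* x (L zero) (K zero))
  *-*-interchange = solve 4 (λ a b c e → a :* b :* (c :* e) := a :* c :* (b :* e)) refl
                      (x ^ L zero) (x ^ K zero) (denB (L ∘ suc) m′) (denB (K ∘ suc) m′)

multinomial : ∀ {d} (P m : Fin d → ℕ) → ℕ
multinomial P m = quotient (denB∣! P m)

!≡multinomial*denB : ∀ {d} (P m : Fin d → ℕ) → (∑ (λ i → P i * m i)) ! ≡ multinomial P m * denB P m
!≡multinomial*denB P m = equality (denB∣! P m)

multinomial>0 : ∀ {d} (P m : Fin d → ℕ) → 0 < multinomial P m
multinomial>0 P m = n≢0⇒n>0 λ q≡0 →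
  ≢-nonZero⁻¹ _ {{∑ (λ i → P i * m i) !≢0}} (trans (!≡multinomial*denB P m) (cong (_* denB P m) q≡0))

multinomial-mono-∣ : ∀ {d} (N L m : Fin d → ℕ) → (∀ i → L i ≤ N i) → multinomial L m ∣ multinomial N m
multinomial-mono-∣ N L m L≤N =
  ∣-trans (m∣m*n (multinomial K m)) (*-cancelʳ-∣ (denB L m * denB K m) {{m*n≢0 _ _ {{denB≢0 L m}} {{denB≢0 K m}}}} (begin
    multinomial L m * multinomial K m * (denB L m * denB K m)   ≡⟨ *-*-interchange ⟩
    multinomial L m * denB L m * (multinomial K m * denB K m)   ≡⟨ cong₂ _*_ (!≡multinomial*denB L m) (!≡multinomial*denB K m) ⟨
    AL ! * AK !                                                 ∣⟨ m!*n!∣[m+n]! AL AK ⟩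
    (AL + AK) !                                                 ≡⟨ cong _! ∑N≡AL+AK ⟨
    (∑ (λ i → N i * m i)) !                                     ≡⟨ !≡multinomial*denB N m ⟩
    multinomial N m * denB N m                                  ≡⟨ cong (multinomial N m *_) (denB-+ N L K m N≡L+K) ⟩
    multinomial N m * (denB L m * denB K m)                     ∎))
  where
  open ∣-Reasoning
  K = λ i → N i ∸ L i
  N≡L+K : ∀ i → N i ≡ L i + K i
  N≡L+K i = sym (m+[n∸m]≡n (L≤N i))
  AL = ∑ (λ i → L i * m i)
  AK = ∑ (λ i → K i * m i)
  ∑N≡AL+AK : ∑ (λ i → N i * m i) ≡ AL + AK
  ∑N≡AL+AK = trans (∑-cong λ i → trans (cong (_* m i) (N≡L+K i)) (*-distribʳ-+ (m i) (L i) (K i)))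
                   (∑-distrib-+ (λ i → L i * m i) (λ i → K i * m i))
  *-*-interchange = solve 4 (λ a b c e → a :* b :* (c :* e) := a :* c :* (b :* e)) refl
                      (multinomial L m) (multinomial K m) (denB L m) (denB K m)

multinomials : ∀ {k d} → (Fin k → Fin d → ℕ) → (Fin d → ℕ) → ℕ
multinomials {zero}  N m = 1
multinomials {suc k} N m = multinomial (N zero) m * multinomials (N ∘ suc) m

multinomials>0 : ∀ {k d} (N : Fin k → Fin d → ℕ) m → 0 < multinomials N m
multinomials>0 {zero}  N m = z<s
multinomials>0 {suc k} N m = m*n>0 (multinomial>0 (N zero) m) (multinomials>0 (N ∘ suc) m)

/≡/ : ∀ a b c e .{{_ : NonZero b}} .{{_ : NonZero e}} → a * e ≡ c * b → (ℤ.+ a) ℚ./ b ≡ (ℤ.+ c) ℚ./ e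
/≡/ a (suc b) c (suc e) a*e≡c*b = ℚP.fromℚᵘ-cong {ℚᵘ.mkℚᵘ (ℤ.+ a) b} {ℚᵘ.mkℚᵘ (ℤ.+ c) e}
  (ℚᵘ.*≡* (trans (sym (ℤP.pos-* a (suc e))) (trans (cong ℤ.+_ a*e≡c*b) (ℤP.pos-* c (suc b)))))

/-homo-* : ∀ a b c e → ((ℤ.+ a) ℚ./ suc b) ℚ.* ((ℤ.+ c) ℚ./ suc e) ≡ (ℤ.+ (a * c)) ℚ./ (suc b * suc e)
/-homo-* a b c e = trans (sym (ℚP.fromℚᵘ-toℚᵘ _))
  (ℚP.fromℚᵘ-cong {_} {ℚᵘ.mkℚᵘ (ℤ.+ (a * c)) (e + b * suc e)}
    (ℚᵘP.≃-trans (ℚP.toℚᵘ-homo-* ((ℤ.+ a) ℚ./ suc b) ((ℤ.+ c) ℚ./ suc e))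
      (ℚᵘP.≃-trans (ℚᵘP.*-cong (ℚP.toℚᵘ-fromℚᵘ (ℚᵘ.mkℚᵘ (ℤ.+ a) b)) (ℚP.toℚᵘ-fromℚᵘ (ℚᵘ.mkℚᵘ (ℤ.+ c) e)))
        (ℚᵘ.*≡* (cong (ℤ._* (ℤ.+ (suc b * suc e))) (sym (ℤP.pos-* a c)))))))

B≡multinomial : ∀ {d} (P m : Fin d → ℕ) → B P m ≡ (ℤ.+ multinomial P m) ℚ./ 1
B≡multinomial P m = /≡/ ((∑ (λ i → P i * m i)) !) (denB P m) (multinomial P m) 1 {{denB≢0 P m}}
  (trans (*-identityʳ _) (!≡multinomial*denB P m))

BN≡multinomials : ∀ {k d} (N : Fin k → Fin d → ℕ) m → BN N m ≡ (ℤ.+ multinomials N m) ℚ./ 1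
BN≡multinomials {zero}  N m = refl
BN≡multinomials {suc k} N m =
  trans (cong₂ ℚ._*_ (B≡multinomial (N zero) m) (BN≡multinomials (N ∘ suc) m))
        (/-homo-* (multinomial (N zero) m) 0 (multinomials (N ∘ suc) m) 0)

Hfrom : ℕ → ℕ → ℚ
Hfrom a zero    = 0ℚ
Hfrom a (suc c) = Hfrom a c ℚ.+ (ℤ.+ 1) ℚ./ suc (a + c)

H-+ : ∀ a c → H (a + c) ≡ H a ℚ.+ Hfrom a c
H-+ a zero    = trans (cong H (+-identityʳ a)) (sym (ℚP.+-identityʳ (H a)))
H-+ a (suc c) = begin
  H (a + suc c)                                   ≡⟨ cong H (+-suc a c) ⟩
  H (a + c) ℚ.+ (ℤ.+ 1) ℚ./ suc (a + c)           ≡⟨ cong (ℚ._+ (ℤ.+ 1) ℚ./ suc (a + c)) (H-+ a c) ⟩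
  H a ℚ.+ Hfrom a c ℚ.+ (ℤ.+ 1) ℚ./ suc (a + c)   ≡⟨ ℚP.+-assoc (H a) (Hfrom a c) _ ⟩
  H a ℚ.+ Hfrom a (suc c)                         ∎
  where open ≡-Reasoning

H-+-H : ∀ a c → H (a + c) - H a ≡ Hfrom a c
H-+-H a c = trans (cong (_- H a) (H-+ a c)) (xyx⁻¹≈y (H a) (Hfrom a c))

BN*H-+-H≡multinomials*Hfrom : ∀ {k d} (N : Fin k → Fin d → ℕ) m q a c
  → (ℤ.+ q) ℚ./ 1 ℚ.* (BN N m ℚ.* (H (a + c) - H a)) ≡ (ℤ.+ (q * multinomials N m)) ℚ./ 1 ℚ.* Hfrom a c
BN*H-+-H≡multinomials*Hfrom N m q a c = begin
  q/1 ℚ.* (BN N m ℚ.* (H (a + c) - H a))   ≡⟨ cong₂ (λ x y → q/1 ℚ.* (x ℚ.* y)) (BN≡multinomials N m) (H-+-H a c) ⟩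
  q/1 ℚ.* (b/1 ℚ.* Hfrom a c)              ≡⟨ ℚP.*-assoc q/1 b/1 (Hfrom a c) ⟨
  q/1 ℚ.* b/1 ℚ.* Hfrom a c                ≡⟨ cong (ℚ._* Hfrom a c) (/-homo-* q 0 (multinomials N m) 0) ⟩
  (ℤ.+ (q * multinomials N m)) ℚ./ 1 ℚ.* Hfrom a c ∎
  where
  open ≡-Reasoning
  q/1 = (ℤ.+ q) ℚ./ 1
  b/1 = (ℤ.+ multinomials N m) ℚ./ 1

∑[L*[m/p]]*p≤∑[L*m] : ∀ {d} (L m : Fin d → ℕ) p .{{_ : NonZero p}} → ∑ (λ i → L i * (m i / p)) * p ≤ ∑ (λ i → L i * m i)
∑[L*[m/p]]*p≤∑[L*m] L m p = subst (_≤ _) (∑-distribʳ-* (λ i → L i * (m i / p)) p) (∑-mono-≤ λ i →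
  subst (_≤ L i * m i) (sym (*-assoc (L i) (m i / p) p)) (*-monoʳ-≤ (L i) (m/n*n≤m (m i) p)))

denominator-/∣ : ∀ i n .{{_ : NonZero n}} → ℚ.denominatorℕ (i ℚ./ n) ∣ n
denominator-/∣ i n = divides g (trans (sym (ℤP.+-injective (trans (ℤP.pos-* (ℚ.denominatorℕ (i ℚ./ n)) g) (ℚP.↧-/ i n)))) (*-comm _ g))
  where g = gcd ℤ.∣ i ∣ n

module PAdic (p : ℕ) (p-prime : Prime p) where

  private instance
    p≢0 : NonZero p
    p≢0 = prime⇒nonZero p-prime

  p>1 : 1 < p
  p>1 = nonTrivial⇒n>1 p {{prime⇒nonTrivial p-prime}}

  p∤1 : ¬ p ∣ 1
  p∤1 p∣1 = <⇒≢ p>1 (sym (∣1⇒≡1 p∣1))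

  p∤* : ∀ {a b} → ¬ p ∣ a → ¬ p ∣ b → ¬ p ∣ a * b
  p∤* {a} {b} p∤a p∤b p∣ab with euclidsLemma a b p-prime p∣ab
  ... | inj₁ p∣a = p∤a p∣a
  ... | inj₂ p∣b = p∤b p∣b

  p∤⇒>0 : ∀ {u} → ¬ p ∣ u → 0 < u
  p∤⇒>0 {zero}  p∤0 = ⊥-elim (p∤0 (p ∣0))
  p∤⇒>0 {suc u} _   = z<s

  InZp-/ : ∀ i n .{{_ : NonZero n}} → ¬ p ∣ n → InZp p (i ℚ./ n)
  InZp-/ i n p∤n p∣den = p∤n (∣-trans p∣den (denominator-/∣ i n))

  InZp-+ : ∀ x y → InZp p x → InZp p y → InZp p (x ℚ.+ y)
  InZp-+ (mkℚ a b _) (mkℚ c e _) x∈ℤₚ y∈ℤₚ =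
    InZp-/ (a ℤ.* ℤ.+ suc e ℤ.+ c ℤ.* ℤ.+ suc b) (suc b * suc e) (p∤* x∈ℤₚ y∈ℤₚ)

  -- ν′ f n divides n by p as long as possible, but at most f times; f = n suffices.
  ν′ : ℕ → ℕ → ℕ
  ν′ zero    n = 0
  ν′ (suc f) n with p ∣? n
  ... | yes _ = suc (ν′ f (n / p))
  ... | no  _ = 0

  ν : ℕ → ℕ
  ν n = ν′ n n

  ν′-p^e*u : ∀ f e u → ¬ p ∣ u → e ≤ f → ν′ f (p ^ e * u) ≡ e
  ν′-p^e*u zero    zero    u p∤u z≤n = refl
  ν′-p^e*u (suc f) zero    u p∤u _ with p ∣? 1 * u
  ... | yes p∣u = ⊥-elim (p∤u (subst (p ∣_) (*-identityˡ u) p∣u))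
  ... | no  _   = refl
  ν′-p^e*u (suc f) (suc e) u p∤u (s≤s e≤f) with p ∣? p * p ^ e * u
  ... | no  p∤ = ⊥-elim (p∤ (∣-trans (m∣m*n (p ^ e)) (m∣m*n u)))
  ... | yes _  = cong suc (trans (cong (ν′ f) divide-out-p) (ν′-p^e*u f e u p∤u e≤f))
    where
    divide-out-p : p * p ^ e * u / p ≡ p ^ e * u
    divide-out-p = trans (cong (_/ p) (solve 3 (λ a b c → a :* b :* c := b :* c :* a) refl p (p ^ e) u))
                         (m*n/n≡m (p ^ e * u) p)

  e<p^e : ∀ e → e < p ^ e
  e<p^e zero    = z<s
  e<p^e (suc e) = ≤-<-trans (e<p^e e) (subst (p ^ e <_) (*-comm (p ^ e) p) (m<m*n (p ^ e) p {{m^n≢0 p e}} p>1))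

  ν-p^e*u : ∀ e u → ¬ p ∣ u → ν (p ^ e * u) ≡ e
  ν-p^e*u e u p∤u =
    ν′-p^e*u _ e u p∤u (≤-trans (<⇒≤ (e<p^e e)) (m≤m*n (p ^ e) u {{>-nonZero (p∤⇒>0 p∤u)}}))

  ν-p^ : ∀ e → ν (p ^ e) ≡ e
  ν-p^ e = trans (cong ν (sym (*-identityʳ (p ^ e)))) (ν-p^e*u e 1 p∤1)

  ν-p∤ : ∀ {u} → ¬ p ∣ u → ν u ≡ 0
  ν-p∤ {u} p∤u = trans (cong ν (sym (*-identityˡ u))) (ν-p^e*u 0 u p∤u)

  factor-out-p : ∀ n → 0 < n → ∃₂ λ e u → ¬ p ∣ u × n ≡ p ^ e * u
  factor-out-p = <-rec _ go
    where
    go : ∀ n → (∀ {q} → q < n → 0 < q → ∃₂ λ e u → ¬ p ∣ u × q ≡ p ^ e * u)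
       → 0 < n → ∃₂ λ e u → ¬ p ∣ u × n ≡ p ^ e * u
    go n rec n>0 with p ∣? n
    ... | no p∤n = 0 , n , p∤n , sym (*-identityˡ n)
    ... | yes (divides q n≡q*p) with rec q<n q>0
      where
      q>0 : 0 < q
      q>0 = n≢0⇒n>0 λ q≡0 → <⇒≢ n>0 (sym (trans n≡q*p (cong (_* p) q≡0)))
      q<n : q < n
      q<n = subst (q <_) (sym n≡q*p) (m<m*n q p {{>-nonZero q>0}} p>1)
    ... | e , u , p∤u , q≡p^e*u = suc e , u , p∤u , trans n≡q*p (trans (cong (_* p) q≡p^e*u)
            (solve 3 (λ a b c → a :* b :* c := c :* a :* b) refl (p ^ e) u p))

  decomposition : ∀ n → 0 < n → ∃ λ u → ¬ p ∣ u × n ≡ p ^ ν n * u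
  decomposition n n>0 with factor-out-p n n>0
  ... | e , u , p∤u , n≡p^e*u =
    u , p∤u , trans n≡p^e*u (cong (λ e → p ^ e * u) (sym (trans (cong ν n≡p^e*u) (ν-p^e*u e u p∤u))))

  ν-* : ∀ {x y} → 0 < x → 0 < y → ν (x * y) ≡ ν x + ν y
  ν-* {x} {y} x>0 y>0 with decomposition x x>0 | decomposition y y>0
  ... | u , p∤u , x≡ | w , p∤w , y≡ = trans (cong ν xy≡) (ν-p^e*u (ν x + ν y) (u * w) (p∤* p∤u p∤w))
    where
    xy≡ : x * y ≡ p ^ (ν x + ν y) * (u * w)
    xy≡ = trans (cong₂ _*_ x≡ y≡) (trans
            (solve 4 (λ a b c d → a :* c :* (b :* d) := a :* b :* (c :* d)) refl (p ^ ν x) (p ^ ν y) u w)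
            (cong (_* (u * w)) (sym (^-distribˡ-+-* p (ν x) (ν y)))))

  ν-^ : ∀ {x} → 0 < x → ∀ k → ν (x ^ k) ≡ k * ν x
  ν-^ x>0 zero    = ν-p∤ p∤1
  ν-^ {x} x>0 (suc k) = trans (ν-* x>0 (m^n>0 x {{>-nonZero x>0}} k)) (cong (ν x +_) (ν-^ x>0 k))

  ν-mono-∣ : ∀ {x y} → x ∣ y → 0 < y → ν x ≤ ν y
  ν-mono-∣ {x} {y} (divides q y≡q*x) y>0 = begin
    ν x         ≤⟨ m≤n+m (ν x) (ν q) ⟩
    ν q + ν x   ≡⟨ ν-* q>0 x>0 ⟨
    ν (q * x)   ≡⟨ cong ν y≡q*x ⟨
    ν y         ∎
    where
    open ≤-Reasoning
    q*x≢0 : q * x ≢ 0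
    q*x≢0 q*x≡0 = <⇒≢ y>0 (sym (trans y≡q*x q*x≡0))
    q>0 : 0 < q
    q>0 = n≢0⇒n>0 λ q≡0 → q*x≢0 (cong (_* x) q≡0)
    x>0 : 0 < x
    x>0 = n≢0⇒n>0 λ x≡0 → q*x≢0 (trans (cong (q *_) x≡0) (*-zeroʳ q))

  p^e∣⇒e≤ν : ∀ {e n} → p ^ e ∣ n → 0 < n → e ≤ ν n
  p^e∣⇒e≤ν {e} p^e∣n n>0 = subst (_≤ _) (ν-p^ e) (ν-mono-∣ p^e∣n n>0)

  e≤ν⇒p^e∣ : ∀ {e n} → 0 < n → e ≤ ν n → p ^ e ∣ n
  e≤ν⇒p^e∣ {e} {n} n>0 e≤ν with decomposition n n>0
  ... | u , _ , n≡p^ν*u = ∣-trans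
    (divides (p ^ (ν n ∸ e)) (trans (cong (p ^_) (sym (m∸n+n≡m e≤ν))) (^-distribˡ-+-* p (ν n ∸ e) e)))
    (divides u (trans n≡p^ν*u (*-comm _ u)))

  InZp-/-ν : ∀ X j .{{_ : NonZero j}} → 0 < X → ν j ≤ ν X → InZp p ((ℤ.+ X) ℚ./ j)
  InZp-/-ν X j X>0 νj≤νX with decomposition j (>-nonZero⁻¹ j) | e≤ν⇒p^e∣ X>0 νj≤νX
  ... | u , p∤u , j≡p^ν*u | divides w X≡w*p^ν = subst (InZp p) (sym X/j≡w/u) (InZp-/ (ℤ.+ w) u p∤u)
    where
    instance u≢0 = >-nonZero (p∤⇒>0 p∤u)
    X/j≡w/u : (ℤ.+ X) ℚ./ j ≡ (ℤ.+ w) ℚ./ u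
    X/j≡w/u = /≡/ X j w u (trans (cong (_* u) X≡w*p^ν) (trans (*-assoc w _ u) (cong (w *_) (sym j≡p^ν*u))))

  X*Hfrom∈ℤₚ : ∀ {X} a c → 0 < X → (∀ j → a < j → j ≤ a + c → ν j ≤ ν X) → InZp p ((ℤ.+ X) ℚ./ 1 ℚ.* Hfrom a c)
  X*Hfrom∈ℤₚ {X} a zero    X>0 νj≤νX = subst (InZp p) (sym (ℚP.*-zeroʳ ((ℤ.+ X) ℚ./ 1))) p∤1
  X*Hfrom∈ℤₚ {X} a (suc c) X>0 νj≤νX =
    subst (InZp p) (sym (ℚP.*-distribˡ-+ X/1 (Hfrom a c) 1/j))
      (InZp-+ (X/1 ℚ.* Hfrom a c) (X/1 ℚ.* 1/j)
        (X*Hfrom∈ℤₚ a c X>0 λ j a<j j≤a+c → νj≤νX j a<j (≤-trans j≤a+c (+-monoʳ-≤ a (n≤1+n c))))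
        (subst (InZp p) (sym X*1/j≡X/j) (InZp-/-ν X (suc (a + c)) X>0 νlast≤νX)))
    where
    X/1 = (ℤ.+ X) ℚ./ 1
    1/j = (ℤ.+ 1) ℚ./ suc (a + c)
    X*1/j≡X/j : X/1 ℚ.* 1/j ≡ (ℤ.+ X) ℚ./ suc (a + c)
    X*1/j≡X/j = trans (/-homo-* X 0 1 (a + c)) (ℚP./-cong (cong ℤ.+_ (*-identityʳ X)) (+-identityʳ _))
    νlast≤νX : ν (suc (a + c)) ≤ ν X
    νlast≤νX = νj≤νX (suc (a + c)) (s≤s (m≤m+n a c)) (≤-reflexive (sym (+-suc a c)))

  ν-[q*p+ρ]! : ∀ q ρ → ρ < p → ν ((q * p + ρ) !) ≡ q + ν (q !)
  ν-[q*p+ρ]! zero    zero    _   = refl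
  ν-[q*p+ρ]! q       (suc ρ) ρ<p = begin
    ν ((q * p + suc ρ) !)   ≡⟨ cong (ν ∘ _!) (+-suc (q * p) ρ) ⟩
    ν (suc x * x !)         ≡⟨ ν-* z<s (1≤n! x) ⟩
    ν (suc x) + ν (x !)     ≡⟨ cong (_+ ν (x !)) (ν-p∤ p∤suc-x) ⟩
    ν (x !)                 ≡⟨ ν-[q*p+ρ]! q ρ (<-trans (n<1+n ρ) ρ<p) ⟩
    q + ν (q !)             ∎
    where
    open ≡-Reasoning
    x = q * p + ρ
    p∤suc-x : ¬ p ∣ suc x
    p∤suc-x p∣ = <⇒≱ ρ<p (∣⇒≤ (∣m+n∣m⇒∣n (subst (p ∣_) (sym (+-suc (q * p) ρ)) p∣) (n∣m*n q)))
  ν-[q*p+ρ]! (suc q) zero    _   = begin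
    ν ((suc q * p + 0) !)                   ≡⟨ cong (ν ∘ _!) (trans (+-identityʳ _) (sym suc-x≡[1+q]*p)) ⟩
    ν (suc x * x !)                         ≡⟨ ν-* z<s (1≤n! x) ⟩
    ν (suc x) + ν (x !)                     ≡⟨ cong₂ _+_ ν-suc-x (ν-[q*p+ρ]! q (p ∸ 1) (∸-monoʳ-< z<s (<⇒≤ p>1))) ⟩
    (ν (suc q) + 1) + (q + ν (q !))         ≡⟨ solve 3 (λ a b c → (a :+ con 1) :+ (b :+ c) := (con 1 :+ b) :+ (a :+ c)) refl (ν (suc q)) q (ν (q !)) ⟩
    suc q + (ν (suc q) + ν (q !))           ≡⟨ cong (suc q +_) (ν-* z<s (1≤n! q)) ⟨
    suc q + ν (suc q !)                     ∎
    where
    open ≡-Reasoning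
    x = q * p + (p ∸ 1)
    suc-x≡[1+q]*p : suc x ≡ suc q * p
    suc-x≡[1+q]*p = trans (sym (+-suc (q * p) (p ∸ 1))) (trans (cong (q * p +_) (m+[n∸m]≡n (<⇒≤ p>1))) (+-comm (q * p) p))
    ν-suc-x : ν (suc x) ≡ ν (suc q) + 1
    ν-suc-x = trans (cong ν suc-x≡[1+q]*p) (trans (ν-* z<s (<-trans z<s p>1)) (cong (ν (suc q) +_) ν-p))
      where ν-p = trans (cong ν (sym (*-identityʳ p))) (ν-p^ 1)

  legendre : ∀ n → ν (n !) ≡ n / p + ν ((n / p) !)
  legendre n = trans (cong (ν ∘ _!) n≡n/p*p+n%p) (ν-[q*p+ρ]! (n / p) (n % p) (m%n<n n p))
    where
    n≡n/p*p+n%p : n ≡ n / p * p + n % p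
    n≡n/p*p+n%p = trans (m≡m%n+[m/n]*n n p) (+-comm (n % p) _)

  ν-denB : ∀ {d} (P m : Fin d → ℕ) → ν (denB P m) ≡ ∑ (λ i → P i * (m i / p)) + ν (denB P (λ i → m i / p))
  ν-denB {zero}  P m = refl
  ν-denB {suc d} P m = begin
    ν ((m₀ !) ^ P₀ * D)                                   ≡⟨ ν-* (m^n>0 (m₀ !) {{m₀ !≢0}} P₀) (denB>0 (P ∘ suc) (m ∘ suc)) ⟩
    ν ((m₀ !) ^ P₀) + ν D                                 ≡⟨ cong₂ _+_ (trans (ν-^ (1≤n! m₀) P₀) (cong (P₀ *_) (legendre m₀))) (ν-denB (P ∘ suc) (m ∘ suc)) ⟩
    P₀ * (q₀ + ν (q₀ !)) + (Q + ν D′)                     ≡⟨ solve 5 (λ a b c e f → a :* (b :+ c) :+ (e :+ f) := a :* b :+ e :+ (a :* c :+ f)) refl P₀ q₀ (ν (q₀ !)) Q (ν D′) ⟩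
    P₀ * q₀ + Q + (P₀ * ν (q₀ !) + ν D′)                  ≡⟨ cong ((P₀ * q₀ + Q) +_) (cong (_+ ν D′) (ν-^ (1≤n! q₀) P₀)) ⟨
    P₀ * q₀ + Q + (ν ((q₀ !) ^ P₀) + ν D′)                ≡⟨ cong ((P₀ * q₀ + Q) +_) (ν-* (m^n>0 (q₀ !) {{q₀ !≢0}} P₀) (denB>0 (P ∘ suc) (λ i → m (suc i) / p))) ⟨
    P₀ * q₀ + Q + ν ((q₀ !) ^ P₀ * D′)                    ∎
    where
    open ≡-Reasoning
    P₀ = P zero
    m₀ = m zero
    q₀ = m₀ / p
    D = denB (P ∘ suc) (m ∘ suc)
    D′ = denB (P ∘ suc) (λ i → m (suc i) / p)
    Q = ∑ (λ i → P (suc i) * (m (suc i) / p))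

  ν-denB≤ : ∀ {d} (P m : Fin d → ℕ) → let Q = ∑ (λ i → P i * (m i / p)) in ν (denB P m) ≤ Q + ν (Q !)
  ν-denB≤ P m = begin
    ν (denB P m)                     ≡⟨ ν-denB P m ⟩
    Q + ν (denB P (λ i → m i / p))   ≤⟨ +-monoʳ-≤ Q (ν-mono-∣ (denB∣! P (λ i → m i / p)) (1≤n! Q)) ⟩
    Q + ν (Q !)                      ∎
    where
    open ≤-Reasoning
    Q = ∑ (λ i → P i * (m i / p))

  r<ν-multinomial : ∀ {d} (L m : Fin d → ℕ) {t r} → p ^ r ∣ t
    → ∑ (λ i → L i * (m i / p)) < t → p * t ≤ ∑ (λ i → L i * m i) → r < ν (multinomial L m)
  r<ν-multinomial L m {t} {r} p^r∣t Q<t p*t≤A = +-cancelʳ-≤ (Q + ν (Q !)) (suc r) (ν (multinomial L m)) (begin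
    suc r + (Q + ν (Q !))                 ≡⟨ solve 3 (λ a b c → con 1 :+ a :+ (b :+ c) := con 1 :+ b :+ (c :+ a)) refl r Q (ν (Q !)) ⟩
    suc Q + (ν (Q !) + r)                 ≤⟨ +-mono-≤ (≤-trans Q<t t≤A/p) (+-monoʳ-≤ (ν (Q !)) (p^e∣⇒e≤ν p^r∣t t>0)) ⟩
    A / p + (ν (Q !) + ν t)               ≡⟨ cong (A / p +_) (ν-* (1≤n! Q) t>0) ⟨
    A / p + ν (Q ! * t)                   ≤⟨ +-monoʳ-≤ (A / p) (ν-mono-∣ (m!*n∣k! Q<t t≤A/p) (1≤n! (A / p))) ⟩
    A / p + ν ((A / p) !)                 ≡⟨ legendre A ⟨
    ν (A !)                               ≡⟨ cong ν (!≡multinomial*denB L m) ⟩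
    ν (multinomial L m * denB L m)        ≡⟨ ν-* (multinomial>0 L m) (denB>0 L m) ⟩
    ν (multinomial L m) + ν (denB L m)    ≤⟨ +-monoʳ-≤ (ν (multinomial L m)) (ν-denB≤ L m) ⟩
    ν (multinomial L m) + (Q + ν (Q !))   ∎)
    where
    open ≤-Reasoning
    A = ∑ (λ i → L i * m i)
    Q = ∑ (λ i → L i * (m i / p))
    t>0 : 0 < t
    t>0 = <-≤-trans z<s Q<t
    t≤A/p : t ≤ A / p
    t≤A/p = subst (_≤ A / p) (m*n/n≡m t p) (/-monoˡ-≤ p (subst (_≤ A) (*-comm p t) p*t≤A))

  ν≤s+ν-multinomial : ∀ {d} (N L m : Fin d → ℕ) → (∀ i → L i ≤ N i) → ∀ s {j}
    → ∑ (λ i → L i * (m i / p)) * p ^ suc s < j → j ≤ ∑ (λ i → L i * m i) * p ^ s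
    → ν j ≤ s + ν (multinomial N m)
  ν≤s+ν-multinomial N L m L≤N s {j} n′<j j≤n with ν j ≤? s
  ... | yes νj≤s = ≤-trans νj≤s (m≤m+n s _)
  ... | no  νj≰s with decomposition j (≤-trans (s≤s z≤n) n′<j)
  ...   | u , p∤u , j≡p^ν*u = begin
    ν j                          ≡⟨ νj≡s+1+r ⟩
    suc s + r                    ≡⟨ +-suc s r ⟨
    s + suc r                    ≤⟨ +-monoʳ-≤ s (≤-trans r<νL νL≤νN) ⟩
    s + ν (multinomial N m)      ∎
    where
    open ≤-Reasoning
    r = ν j ∸ suc s
    t = p ^ r * u
    νj≡s+1+r : ν j ≡ suc s + r
    νj≡s+1+r = sym (m+[n∸m]≡n (≰⇒> νj≰s))
    j≡p^[s+1]*t : j ≡ p ^ suc s * t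
    j≡p^[s+1]*t = trans j≡p^ν*u (trans (cong (λ e → p ^ e * u) νj≡s+1+r)
                    (trans (cong (_* u) (^-distribˡ-+-* p (suc s) r)) (*-assoc (p ^ suc s) (p ^ r) u)))
    Q<t : ∑ (λ i → L i * (m i / p)) < t
    Q<t = *-cancelʳ-< (p ^ suc s) _ t (subst (_ <_) (trans j≡p^[s+1]*t (*-comm (p ^ suc s) t)) n′<j)
    p*t≤A : p * t ≤ ∑ (λ i → L i * m i)
    p*t≤A = *-cancelʳ-≤ (p * t) _ (p ^ s) {{m^n≢0 p s}} (subst (_≤ _) j≡p*t*p^s j≤n)
      where
      j≡p*t*p^s : j ≡ p * t * p ^ s
      j≡p*t*p^s = trans j≡p^[s+1]*t (solve 3 (λ a b c → a :* b :* c := a :* c :* b) refl p (p ^ s) t)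
    r<νL : r < ν (multinomial L m)
    r<νL = r<ν-multinomial L m (divides u (*-comm (p ^ r) u)) Q<t p*t≤A
    νL≤νN : ν (multinomial L m) ≤ ν (multinomial N m)
    νL≤νN = ν-mono-∣ (multinomial-mono-∣ N L m L≤N) (multinomial>0 N m)

  ν≤ν[p^s*multinomials] : ∀ {k d} (N : Fin (suc k) → Fin d → ℕ) (L m : Fin d → ℕ) → (∀ i → L i ≤ N zero i)
    → ∀ s {j} → ∑ (λ i → L i * (m i / p)) * p ^ suc s < j → j ≤ ∑ (λ i → L i * m i) * p ^ s
    → ν j ≤ ν (p ^ s * multinomials N m)
  ν≤ν[p^s*multinomials] N L m L≤N s {j} n′<j j≤n = begin
    ν j                               ≤⟨ ν≤s+ν-multinomial (N zero) L m L≤N s n′<j j≤n ⟩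
    s + ν (multinomial (N zero) m)    ≤⟨ +-monoʳ-≤ s (ν-mono-∣ (m∣m*n {multinomial (N zero) m} (multinomials (N ∘ suc) m)) b>0) ⟩
    s + ν b                           ≡⟨ cong (_+ ν b) (ν-p^ s) ⟨
    ν (p ^ s) + ν b                   ≡⟨ ν-* (m^n>0 p s) b>0 ⟨
    ν (p ^ s * b)                     ∎
    where
    open ≤-Reasoning
    b = multinomials N m
    b>0 : 0 < b
    b>0 = multinomials>0 N m

lemma4 : (p : ℕ) → Prime p → .{{_ : NonZero p}} → (d k s : ℕ) → 0 < d → (hk : 0 < k)
    → (m L : Fin d → ℕ) → (N : Fin k → Fin d → ℕ)
    → (∀ i → L i ≤ N (fromℕ< hk) i)
    → InPowZp p s (BN N m *ℚ (H (∑ (λ i → L i * m i * p ^ s)) - H (∑ (λ i → L i * (m i / p) * p ^ (suc s)))))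
lemma4 p p-prime _ (suc k) s _ (s≤s z≤n) m L N L≤N =
  subst (InZp p) X*Hfrom≡p^s*BN*ΔH (X*Hfrom∈ℤₚ n′ (n ∸ n′) X>0 λ j n′<j j≤n →
    ν≤ν[p^s*multinomials] N L m L≤N s (subst (_< j) n′≡Q*p^[s+1] n′<j) (subst (j ≤_) (trans n′+[n∸n′]≡n n≡A*p^s) j≤n))
  where
  open PAdic p p-prime
  A = ∑ (λ i → L i * m i)
  Q = ∑ (λ i → L i * (m i / p))
  n = ∑ (λ i → L i * m i * p ^ s)
  n′ = ∑ (λ i → L i * (m i / p) * p ^ suc s)
  X = p ^ s * multinomials N m
  X>0 : 0 < X
  X>0 = m*n>0 (m^n>0 p s) (multinomials>0 N m)
  n≡A*p^s : n ≡ A * p ^ s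
  n≡A*p^s = ∑-distribʳ-* (λ i → L i * m i) (p ^ s)
  n′≡Q*p^[s+1] : n′ ≡ Q * p ^ suc s
  n′≡Q*p^[s+1] = ∑-distribʳ-* (λ i → L i * (m i / p)) (p ^ suc s)
  n′+[n∸n′]≡n : n′ + (n ∸ n′) ≡ n
  n′+[n∸n′]≡n = m+[n∸m]≡n (subst₂ _≤_ (sym (trans n′≡Q*p^[s+1] (sym (*-assoc Q p (p ^ s))))) (sym n≡A*p^s)
                   (*-monoˡ-≤ (p ^ s) (∑[L*[m/p]]*p≤∑[L*m] L m p)))
  X*Hfrom≡p^s*BN*ΔH : (ℤ.+ X) ℚ./ 1 ℚ.* Hfrom n′ (n ∸ n′)
                      ≡ (ℤ.+ (p ^ s)) ℚ./ 1 ℚ.* (BN N m *ℚ (H n - H n′))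
  X*Hfrom≡p^s*BN*ΔH = sym (trans (cong (λ z → (ℤ.+ (p ^ s)) ℚ./ 1 ℚ.* (BN N m *ℚ (H z - H n′))) (sym n′+[n∸n′]≡n))
                                 (BN*H-+-H≡multinomials*Hfrom N m (p ^ s) n′ (n ∸ n′)))
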